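{- Let $m,n,s,k,\lambda,t$ be positive integers and suppose there exists a ${}^{\lambda}\mathrm{H}_t(m,n;s,k)$; set $v=\frac{2nk}{\lambda}+t$. If either $v$ is odd, or $v$ and $t$ are both even, then $\lambda$ divides $nk$.
   Context: A partially filled (p.f.) $m\times n$ array is an $m\times n$ matrix in which some cells may be empty. Let $t$ divide $\frac{2nk}{\lambda}$, put $v=\frac{2nk}{\lambda}+t$ and let $J$ be the subgroup of $\mathbb{Z}_v$ of order $t$. A $\lambda$-fold Heffter array over $\mathbb{Z}_v$ relative to $J$, denoted ${}^{\lambda}\mathrm{H}_t(m,n;s,k)$, is an $m\times n$ p.f. array with entries in $\mathbb{Z}_v$ such that: (a) each row has exactly $s$ filled cells and each column exactly $k$ filled cells; (b) the multiset $\{\pm x : x \text{ an entry of a filled cell}\}$ (with multiplicity over all filled cells) contains each element of $\mathbb{Z}_v\setminus J$ exactly $\lambda$ times; (c) the entries of every row and every column sum to $0$ in $\mathbb{Z}_v$. -}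

module Defs where

open import Data.Nat using (ℕ; zero; suc; _+_; _*_)
open import Data.Nat.Divisibility using (_∣_; _∣?_)
open import Data.Fin using (Fin; toℕ)
open import Data.Fin.Properties using (_≟_)
open import Data.List using (List; map; allFin; concatMap)
open import Data.Nat.ListAction using (sum)
open import Data.Maybe using (Maybe; just; nothing)
open import Data.Product using (_×_; _,_)
open import Data.Bool using (Bool; true; false; if_then_else_)
open import Relation.Nullary.Decidable using (does)
open import Relation.Nullary using (¬_)
open import Relation.Binary.PropositionalEquality using (_≡_)

-- Elements of ℤ_v are represented by Fin v (canonical residues 0..v-1).
-- A partially filled m×n array over ℤ_v: an empty cell is 'nothing'.
PFArray : ℕ → ℕ → ℕ → Set
PFArray m n v = Fin m → Fin n → Maybe (Fin v)

[_] : Bool → ℕ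
[ b ] = if b then 1 else 0

isFilled : ∀ {v} → Maybe (Fin v) → Bool
isFilled (just _) = true
isFilled nothing  = false

val : ∀ {v} → Maybe (Fin v) → ℕ
val (just x) = toℕ x
val nothing  = 0

rowFilled : ∀ {m n v} → PFArray m n v → Fin m → ℕ
rowFilled {n = n} A i = sum (map (λ j → [ isFilled (A i j) ]) (allFin n))

colFilled : ∀ {m n v} → PFArray m n v → Fin n → ℕ
colFilled {m = m} A j = sum (map (λ i → [ isFilled (A i j) ]) (allFin m))

-- row / column sums, computed in ℕ on representatives (zero in ℤ_v iff v divides it)
rowSum : ∀ {m n v} → PFArray m n v → Fin m → ℕ
rowSum {n = n} A i = sum (map (λ j → val (A i j)) (allFin n))

colSum : ∀ {m n v} → PFArray m n v → Fin n → ℕ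
colSum {m = m} A j = sum (map (λ i → val (A i j)) (allFin m))

-- number of times y occurs in the multiset {x, -x} contributed by one cell
-- (y = x  contributes 1;  y = -x, i.e. v ∣ x + y,  contributes 1; empty cell contributes 0)
cellMult : ∀ {v} → Fin v → Maybe (Fin v) → ℕ
cellMult y nothing  = 0
cellMult {v} y (just x) = [ does (x ≟ y) ] + [ does (v ∣? (toℕ x + toℕ y)) ]

allCells : (m n : ℕ) → List (Fin m × Fin n)
allCells m n = concatMap (λ i → map (λ j → (i , j)) (allFin n)) (allFin m)

mult : ∀ {m n v} → PFArray m n v → Fin v → ℕ
mult {m} {n} A y = sum (map (λ { (i , j) → cellMult y (A i j) }) (allCells m n))

-- λ-fold Heffter array ^λH_t(m,n;s,k).
-- q = 2nk/λ (so λ * q ≡ 2nk), t ∣ q witnessed by q ≡ t * r, and v = q + t.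
-- The subgroup J of ℤ_v of order t is { x : (v/t) ∣ x } where v/t = r + 1.
record Heffter (m n s k lam t : ℕ) : Set where
  field
    q     : ℕ
    r     : ℕ
    q-def : lam * q ≡ 2 * n * k
    t∣q   : q ≡ t * r
  v : ℕ
  v = q + t
  inJ : Fin v → Set
  inJ x = suc r ∣ toℕ x
  field
    A        : PFArray m n v
    rows-s   : ∀ i → rowFilled A i ≡ s
    cols-k   : ∀ j → colFilled A j ≡ k
    mult-lam : ∀ (y : Fin v) → ¬ inJ y → mult A y ≡ lam
    row-zero : ∀ i → v ∣ rowSum A i
    col-zero : ∀ j → v ∣ colSum A j

module Submission where

open import Defs
open import Data.Nat using (ℕ; _*_; _<_; _+_; suc; NonZero)
open import Data.Nat.Divisibility
  using (_∣_; ∣-refl; ∣m∣n⇒∣m+n; ∣m+n∣m⇒∣n; ∣n⇒∣m*n; *-monoʳ-∣; *-cancelʳ-∣)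
open import Data.Nat.Properties using (+-comm; *-comm; *-assoc; *-suc)
open import Data.Product using (_×_; _,_)
open import Data.Sum using (_⊎_; inj₁; inj₂)
open import Relation.Nullary using (¬_; contradiction)
open import Relation.Binary.PropositionalEquality using (_≡_; sym; subst)

-- A Heffter array has λ q = 2nk with q = 2nk/λ, so λ ∣ nk exactly when q is even;
-- the parity hypotheses on v = q + t = t (r + 1), where q = t r, force q to be even.

2∣n⊎2∣1+n : ∀ n → 2 ∣ n ⊎ 2 ∣ suc n
2∣n⊎2∣1+n 0       = inj₁ (∣n⇒∣m*n 0 ∣-refl)
2∣n⊎2∣1+n (suc n) with 2∣n⊎2∣1+n n
... | inj₁ 2∣n   = inj₂ (∣m∣n⇒∣m+n ∣-refl 2∣n)
... | inj₂ 2∣1+n = inj₁ 2∣1+n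

2∤m*n+m⇒2∣m*n : ∀ m n → ¬ 2 ∣ m * n + m → 2 ∣ m * n
2∤m*n+m⇒2∣m*n m n 2∤mn+m with 2∣n⊎2∣1+n n
... | inj₁ 2∣n   = ∣n⇒∣m*n m 2∣n
... | inj₂ 2∣1+n = contradiction (subst (2 ∣_) m*[1+n]≡m*n+m (∣n⇒∣m*n m 2∣1+n)) 2∤mn+m
  where
  m*[1+n]≡m*n+m : m * suc n ≡ m * n + m
  m*[1+n]≡m*n+m = subst (m * suc n ≡_) (+-comm m (m * n)) (*-suc m n)

∣m+n∣n⇒∣m : ∀ {d} m n → d ∣ m + n → d ∣ n → d ∣ m
∣m+n∣n⇒∣m {d} m n d∣m+n = ∣m+n∣m⇒∣n (subst (d ∣_) (+-comm m n) d∣m+n)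

m*n≡o*p∧o∣n⇒m∣p : ∀ {m n o p} .{{_ : NonZero o}} → m * n ≡ o * p → o ∣ n → m ∣ p
m*n≡o*p∧o∣n⇒m∣p {m} {n} {o} {p} mn≡op o∣n =
  *-cancelʳ-∣ o (subst (m * o ∣_) mn≡po (*-monoʳ-∣ m o∣n))
  where
  mn≡po : m * n ≡ p * o
  mn≡po = subst (m * n ≡_) (*-comm o p) mn≡op

parity⇒2∣q : ∀ q t r → q ≡ t * r → ¬ 2 ∣ q + t ⊎ (2 ∣ q + t × 2 ∣ t) → 2 ∣ q
parity⇒2∣q q t r q≡tr (inj₁ 2∤q+t) =
  subst (2 ∣_) (sym q≡tr) (2∤m*n+m⇒2∣m*n t r (subst (λ x → ¬ 2 ∣ x + t) q≡tr 2∤q+t))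
parity⇒2∣q q t r _ (inj₂ (2∣q+t , 2∣t)) = ∣m+n∣n⇒∣m q t 2∣q+t 2∣t

proposition4p1 : (m n s k lam t : ℕ) → 0 < m → 0 < n → 0 < s → 0 < k → 0 < lam → 0 < t →
    (H : Heffter m n s k lam t) →
    (¬ (2 ∣ Heffter.v H) ⊎ (2 ∣ Heffter.v H × 2 ∣ t)) →
    lam ∣ n * k
proposition4p1 m n s k lam t _ _ _ _ _ _ H parity =
  m*n≡o*p∧o∣n⇒m∣p (subst (lam * q ≡_) (*-assoc 2 n k) q-def) (parity⇒2∣q q t r t∣q parity)
  where open Heffter H using (q; r; q-def; t∣q)
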